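{- Let $G$ be a graph with $n$ vertices and minimum degree $\delta(G)>\frac45 n$. Let $O=(x_1,x_2,x_3,x_4)\in\mathcal{OK}_4(G)$ and $R=N(x_1,x_2,x_3,x_4)$. Then: (1) If $W'_G(O)\leqslant1$, then $W_G(O)\geqslant0$. (2) \begin{align*} W'_G(O)=\frac{1}{W(x_1,x_2,x_3)}\sum_{y\in R}\Big[&2W(x_1,y,x_2,x_3)-W(x_1,x_2,x_3,y)-W(x_1,x_2,y,x_3)\\ &+\sum_{z\in N(y)\cap R}\big(2W(x_1,y,x_2,x_3,z)+2W(x_1,y,x_2,z,x_3)+2W(x_1,y,z,x_2,x_3)\\ &-W(x_1,x_2,x_3,y,z)-W(x_1,x_2,y,x_3,z)-W(x_1,x_2,y,z,x_3)-3W(y,z,x_1,x_2,x_3)\big)\Big]. \end{align*}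
   Context: For $S\subseteq V(G)$ nonempty, $N(S)=\bigcap_{v\in S}N(v)$, also written $N(v_1,\dots,v_r)$. An ordered $l$-clique is an $l$-tuple of distinct vertices forming a clique; $\mathcal{OK}_l(G)$ is the set of them, and $V((v_1,\dots,v_l))=\{v_1,\dots,v_l\}$. For $O=(u_1,\dots,u_4)\in\mathcal{OK}_4(G)$, $\mathcal{OK}_6(G,O)$ is the set of $(v_1,\dots,v_6)\in\mathcal{OK}_6(G)$ such that $u_1u_2u_3u_4$ is a (not necessarily consecutive) subsequence of $v_1\dots v_6$. For $(v_1,\dots,v_r)\in\mathcal{OK}_r(G)$, $r\in\{2,\dots,5\}$, $W(v_1,\dots,v_r)=\prod_{i=2}^r\frac1{|N(v_1,\dots,v_i)|}$. For a copy $K$ of $K_6$ in $G$ and an edge $e$ of $K$, $\psi_{K,e}$ assigns to a copy $T$ of $K_4$ in $G$ the value $\frac12$ if $T\subseteq K$ and $e\cap V(T)=\emptyset$; $-\frac16$ if $T\subseteq K$ and $|e\cap V(T)|=1$; $\frac16$ if $T\subseteq K$ and $e\in E(T)$; $0$ otherwise. Define $$W_G(O)=\frac12\sum_{K=(v_1,\dots,v_6)\in\mathcal{OK}_6(G,O)}W(v_1,\dots,v_5)\,\psi_{G[V(K)],\{v_1,v_2\}}(G[V(O)])$$ and, for $O=(x_1,x_2,x_3,x_4)$, $W'_G(O)=1-\frac{12}{W(x_1,x_2,x_3)}W_G(O)$. -}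

module Defs where

open import Data.Bool using (Bool; true; false; _∧_; _∨_; not; if_then_else_; T)
open import Data.Bool.Properties using (T?)
open import Data.Nat as ℕ using (ℕ; zero; suc)
open import Data.Fin using (Fin)
open import Data.Fin.Properties using () renaming (_≟_ to _≟ᶠ_)
open import Data.List using (List; []; _∷_; [_]; _++_; allFin; filter; length; map; foldr)
open import Data.Bool.ListAction using (all; any)
open import Data.Integer using (+_; -[1+_])
open import Data.Rational using (ℚ; 0ℚ; 1ℚ; _+_; _*_; _-_; _/_; 1/_; ≢-nonZero)
open import Data.Rational.Properties using () renaming (_≟_ to _≟ℚ_)
open import Relation.Nullary using (does; yes; no)
open import Relation.Binary.PropositionalEquality using (_≡_)

record Graph (n : ℕ) : Set where
  field
    adj    : Fin n → Fin n → Bool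
    sym    : ∀ u v → adj u v ≡ adj v u
    irrefl : ∀ v → adj v v ≡ false
open Graph public

-- total inverse on ℚ (convention 1/0 = 0; only applied to nonzero values
-- under the hypotheses of the lemma)
inv : ℚ → ℚ
inv q with q ≟ℚ 0ℚ
... | yes _  = 0ℚ
... | no q≢0 = 1/_ q {{≢-nonZero q≢0}}

module _ {n : ℕ} (G : Graph n) where

  open import Data.List.Relation.Binary.Sublist.DecPropositional (_≟ᶠ_ {n}) using (_⊆?_)

  deg : Fin n → ℕ
  deg v = length (filter (λ w → T? (adj G v w)) (allFin n))

  mem : Fin n → List (Fin n) → Bool
  mem v l = any (λ w → does (v ≟ᶠ w)) l

  inN : List (Fin n) → Fin n → Bool
  inN S w = all (λ v → adj G v w) S

  Nsize : List (Fin n) → ℕ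
  Nsize S = length (filter (λ w → T? (inN S w)) (allFin n))

  -- the tuple (v₁,…,v_l) is an ordered clique: pairwise adjacent
  -- (pairwise distinctness follows since adjacency is irreflexive)
  isClique : List (Fin n) → Bool
  isClique []       = true
  isClique (v ∷ vs) = all (adj G v) vs ∧ isClique vs

  OK : List (Fin n) → Set
  OK l = T (isClique l)

  -- W(v₁,…,v_r) = ∏_{i=2}^r 1 / |N(v₁,…,v_i)|
  Wfrom : List (Fin n) → List (Fin n) → ℚ
  Wfrom pre []         = 1ℚ
  Wfrom pre (v ∷ rest) = invℕ (Nsize (pre ++ [ v ])) * Wfrom (pre ++ [ v ]) rest
    where
      invℕ : ℕ → ℚ
      invℕ zero    = 0ℚ
      invℕ (suc k) = + 1 / suc k

  W : List (Fin n) → ℚ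
  W []       = 1ℚ
  W (v ∷ vs) = Wfrom [ v ] vs

  ψ : List (Fin n) → Fin n → Fin n → List (Fin n) → ℚ
  ψ K a b Tv =
    if all (λ t → mem t K) Tv
    then (if (not (mem a Tv)) ∧ (not (mem b Tv)) then + 1 / 2
          else if (mem a Tv ∧ not (mem b Tv)) ∨ (not (mem a Tv) ∧ mem b Tv) then -[1+ 0 ] / 6
          else if mem a Tv ∧ mem b Tv ∧ adj G a b then + 1 / 6
          else 0ℚ)
    else 0ℚ

  Σᵥ : (Fin n → ℚ) → ℚ
  Σᵥ f = foldr _+_ 0ℚ (map f (allFin n))

  WG : List (Fin n) → ℚ
  WG O = (+ 1 / 2) *
    Σᵥ λ v₁ → Σᵥ λ v₂ → Σᵥ λ v₃ → Σᵥ λ v₄ → Σᵥ λ v₅ → Σᵥ λ v₆ →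
      let K = v₁ ∷ v₂ ∷ v₃ ∷ v₄ ∷ v₅ ∷ v₆ ∷ [] in
      if isClique K ∧ does (O ⊆? K)
      then W (v₁ ∷ v₂ ∷ v₃ ∷ v₄ ∷ v₅ ∷ []) * ψ K v₁ v₂ O
      else 0ℚ

  W' : Fin n → Fin n → Fin n → Fin n → ℚ
  W' x₁ x₂ x₃ x₄ =
    1ℚ - ((+ 12 / 1) * inv (W (x₁ ∷ x₂ ∷ x₃ ∷ []))) * WG (x₁ ∷ x₂ ∷ x₃ ∷ x₄ ∷ [])

  MinDegGt45 : Set
  MinDegGt45 = ∀ v → 4 ℕ.* n ℕ.< 5 ℕ.* deg v

{-# OPTIONS --safe #-}
module Submission where

open import Defs
open import Data.Nat using (ℕ)
open import Data.Fin using (Fin)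
open import Data.Bool using (_∧_; if_then_else_)
open import Data.List using (_∷_; [])
open import Data.Integer using (+_)
open import Data.Product using (_×_)
open import Data.Rational using (ℚ; 0ℚ; 1ℚ; _+_; _*_; _-_; _/_; _≤_)
open import Relation.Binary.PropositionalEquality using (_≡_)

open import Algebra.Bundles using (CommutativeMonoid)
open import Data.Bool using (Bool; true; false; not; T; _∨_)
open import Data.Bool.ListAction using (all)
open import Data.Bool.Properties
  using (T?; T-≡; if-∧; if-eta; if-cong; ∧-comm; ∧-identityʳ; ∨-zeroʳ; ∧-conicalˡ; ∧-conicalʳ;
         ∧-isCommutativeMonoid; ∧-commutativeMonoid)
open import Algebra.Properties.CommutativeSemigroup (CommutativeMonoid.commutativeSemigroup ∧-commutativeMonoid)
  using (interchange)
open import Data.Fin using (zero; suc)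
open import Data.Fin.Properties using () renaming (_≟_ to _≟ᶠ_)
open import Data.Integer using (-[1+_])
import Data.Integer as ℤ
open import Data.Integer.Tactic.RingSolver using () renaming (solve-∀ to solve-∀ℤ)
open import Data.List using (List; [_]; _++_; _∷ʳ_; allFin; filter; length; map; foldr)
import Data.List.Properties as List
open import Data.List.Membership.Propositional using (_∈_)
open import Data.List.Relation.Unary.Any using (here; there)
open import Data.List.Relation.Binary.Permutation.Propositional as ↭ using (_↭_; ↭⇒↭ₛ)
import Data.List.Relation.Binary.Permutation.Propositional.Properties as ↭
import Data.List.Relation.Binary.Permutation.Setoid.Properties as ↭ₛ
open import Data.Nat as ℕ using (zero; suc; z≤n; s≤s)
import Data.Nat.Properties as ℕ
open import Data.Nat.Tactic.RingSolver using () renaming (solve-∀ to solve-∀ℕ)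
open import Data.Product using (_,_; proj₁; proj₂)
open import Data.Rational using (Positive; ≢-nonZero; toℚᵘ)
import Data.Rational.Properties as ℚ
import Data.Rational.Unnormalised as ℚᵘ
import Data.Rational.Unnormalised.Properties as ℚᵘ
open import Function using (_∘_)
open import Function.Bundles using (Equivalence)
open import Level using (0ℓ)
open import Relation.Nullary using (does; yes; no; contradiction)
open import Relation.Nullary.Decidable using (dec⇒maybe)
import Relation.Binary.PropositionalEquality as ≡
open import Relation.Binary.PropositionalEquality
  using (refl; trans; cong; cong₂; subst; subst₂; module ≡-Reasoning)
open import Tactic.RingSolver using (solve-∀)
open import Tactic.RingSolver.Core.AlmostCommutativeRing using (AlmostCommutativeRing; fromCommutativeRing)

-- A 6-clique containing O as a subsequence is O with two further adjacent
-- vertices a, b ∈ R = N(x₁,…,x₄) inserted at positions i < j, and ψ only sees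
-- how many of a, b occupy the first two positions, so 2 W_G(O) splits into
-- 15 sums over such placements. When b comes last it ranges over the common
-- neighbourhood of the first five vertices, whose size is the last factor of
-- W; summing over b therefore just drops that factor, exactly because
-- δ(G) > 4n/5 gives any five vertices a common neighbour. Doing this twice
-- for the placement (5,6) leaves W(x₁,x₂,x₃)/6, and, W being symmetric in its
-- first two arguments, all other placements add up to −1/6 of the bracket
-- in (2): 12 W_G(O) = W(x₁,x₂,x₃) − Σ_y [⋯]. Both claims follow because
-- W(x₁,x₂,x₃) > 0.

ℚ-ring : AlmostCommutativeRing 0ℓ 0ℓ
ℚ-ring = fromCommutativeRing ℚ.+-*-commutativeRing (λ q → dec⇒maybe (0ℚ ℚ.≟ q))

fromℕ : ℕ → ℚ
fromℕ m = + m / 1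

fromℕ-suc : ∀ m → fromℕ (suc m) ≡ 1ℚ + fromℕ m
fromℕ-suc m = ℚ.toℚᵘ-injective (begin
  toℚᵘ (fromℕ (suc m))       ≈⟨ ℚ.toℚᵘ-fromℚᵘ (ℚᵘ.mkℚᵘ (+ suc m) 0) ⟩
  ℚᵘ.mkℚᵘ (+ suc m) 0          ≈⟨ ℚᵘ.*≡* (cross-multiplied (+ m)) ⟩
  ℚᵘ.1ℚᵘ ℚᵘ.+ ℚᵘ.mkℚᵘ (+ m) 0  ≈⟨ ℚᵘ.+-congʳ ℚᵘ.1ℚᵘ (ℚ.toℚᵘ-fromℚᵘ (ℚᵘ.mkℚᵘ (+ m) 0)) ⟨
  toℚᵘ 1ℚ ℚᵘ.+ toℚᵘ (fromℕ m) ≈⟨ ℚ.toℚᵘ-homo-+ 1ℚ (fromℕ m) ⟨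
  toℚᵘ (1ℚ + fromℕ m)        ∎)
  where
    open ℚᵘ.≃-Reasoning
    cross-multiplied : ∀ (k : ℤ.ℤ) → (+ 1 ℤ.+ k) ℤ.* (+ 1 ℤ.* + 1) ≡ (+ 1 ℤ.* + 1 ℤ.+ k ℤ.* + 1) ℤ.* + 1
    cross-multiplied = solve-∀ℤ

fromℕ*1/ : ∀ m → fromℕ (suc m) * (+ 1 / suc m) ≡ 1ℚ
fromℕ*1/ m = ℚ.toℚᵘ-injective (begin
  toℚᵘ (fromℕ (suc m) * (+ 1 / suc m))        ≈⟨ ℚ.toℚᵘ-homo-* (fromℕ (suc m)) (+ 1 / suc m) ⟩
  toℚᵘ (fromℕ (suc m)) ℚᵘ.* toℚᵘ (+ 1 / suc m)
    ≈⟨ ℚᵘ.*-cong (ℚ.toℚᵘ-fromℚᵘ (ℚᵘ.mkℚᵘ (+ suc m) 0)) (ℚ.toℚᵘ-fromℚᵘ (ℚᵘ.mkℚᵘ (+ 1) m)) ⟩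
  ℚᵘ.mkℚᵘ (+ suc m) 0 ℚᵘ.* ℚᵘ.mkℚᵘ (+ 1) m      ≈⟨ ℚᵘ.*≡* (cross-multiplied (+ suc m)) ⟩
  toℚᵘ 1ℚ                                      ∎)
  where
    open ℚᵘ.≃-Reasoning
    cross-multiplied : ∀ (k : ℤ.ℤ) → (k ℤ.* + 1) ℤ.* + 1 ≡ + 1 ℤ.* (+ 1 ℤ.* k)
    cross-multiplied = solve-∀ℤ

𝟙 : Bool → ℚ
𝟙 b = if b then 1ℚ else 0ℚ

if-then-0≡𝟙* : ∀ b x → (if b then x else 0ℚ) ≡ 𝟙 b * x
if-then-0≡𝟙* true  x = ≡.sym (ℚ.*-identityˡ x)
if-then-0≡𝟙* false x = ≡.sym (ℚ.*-zeroˡ x)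

𝟙-∧ : ∀ a b → 𝟙 (a ∧ b) ≡ 𝟙 a * 𝟙 b
𝟙-∧ true  b = ≡.sym (ℚ.*-identityˡ (𝟙 b))
𝟙-∧ false b = ≡.sym (ℚ.*-zeroˡ (𝟙 b))

𝟙*-cong : ∀ b {x y} → (b ≡ true → x ≡ y) → 𝟙 b * x ≡ 𝟙 b * y
𝟙*-cong true  x≡y = cong (1ℚ *_) (x≡y refl)
𝟙*-cong false {x} {y} _ = trans (ℚ.*-zeroˡ x) (≡.sym (ℚ.*-zeroˡ y))

*-distribˡ-+₃ : ∀ c p q r → c * ((p + q) + r) ≡ (c * p + c * q) + c * r
*-distribˡ-+₃ = solve-∀ ℚ-ring

*-distribˡ-+₄ : ∀ c p q r s → c * (((p + q) + r) + s) ≡ ((c * p + c * q) + c * r) + c * s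
*-distribˡ-+₄ = solve-∀ ℚ-ring

inv-inverseˡ : ∀ q → Positive q → inv q * q ≡ 1ℚ
inv-inverseˡ q q>0 with q ℚ.≟ 0ℚ
... | yes refl = contradiction (ℚ.positive⁻¹ 0ℚ {{q>0}}) (ℚ.<-irrefl refl)
... | no  q≢0  = ℚ.*-inverseˡ q {{≢-nonZero q≢0}}

inv-pos : ∀ q → Positive q → Positive (inv q)
inv-pos q q>0 with q ℚ.≟ 0ℚ
... | yes refl = contradiction (ℚ.positive⁻¹ 0ℚ {{q>0}}) (ℚ.<-irrefl refl)
... | no  _    = ℚ.1/pos⇒pos q {{q>0}}

1-p≤1⇒0≤p : ∀ p → 1ℚ - p ≤ 1ℚ → 0ℚ ≤ p
1-p≤1⇒0≤p p 1-p≤1 = subst₂ _≤_ (lhs p) (rhs p) (ℚ.+-monoˡ-≤ (p - 1ℚ) 1-p≤1)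
  where
    lhs : ∀ p → 1ℚ - p + (p - 1ℚ) ≡ 0ℚ
    lhs = solve-∀ ℚ-ring
    rhs : ∀ p → 1ℚ + (p - 1ℚ) ≡ p
    rhs = solve-∀ ℚ-ring

module _ {A : Set} where

  ∑ : List A → (A → ℚ) → ℚ
  ∑ xs f = foldr _+_ 0ℚ (map f xs)

  ∑-cong : ∀ xs {f g : A → ℚ} → (∀ x → f x ≡ g x) → ∑ xs f ≡ ∑ xs g
  ∑-cong xs f≗g = cong (foldr _+_ 0ℚ) (List.map-cong f≗g xs)

  ∑-zero : ∀ xs {f : A → ℚ} → (∀ x → f x ≡ 0ℚ) → ∑ xs f ≡ 0ℚ
  ∑-zero []       f≗0 = refl
  ∑-zero (x ∷ xs) f≗0 = cong₂ _+_ (f≗0 x) (∑-zero xs f≗0)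

  ∑-distrib-+ : ∀ xs (f g : A → ℚ) → ∑ xs (λ x → f x + g x) ≡ ∑ xs f + ∑ xs g
  ∑-distrib-+ []       f g = refl
  ∑-distrib-+ (x ∷ xs) f g =
    trans (cong (_+_ (f x + g x)) (∑-distrib-+ xs f g)) (interchange⁺ (f x) (g x) (∑ xs f) (∑ xs g))
    where
      interchange⁺ : ∀ a b c d → (a + b) + (c + d) ≡ (a + c) + (b + d)
      interchange⁺ = solve-∀ ℚ-ring

  *-distribˡ-∑ : ∀ xs c (f : A → ℚ) → ∑ xs (λ x → c * f x) ≡ c * ∑ xs f
  *-distribˡ-∑ []       c f = ≡.sym (ℚ.*-zeroʳ c)
  *-distribˡ-∑ (x ∷ xs) c f =
    trans (cong (_+_ (c * f x)) (*-distribˡ-∑ xs c f)) (≡.sym (ℚ.*-distribˡ-+ c (f x) (∑ xs f)))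

  count : (A → Bool) → List A → ℕ
  count p xs = length (filter (T? ∘ p) xs)

  ∑-𝟙* : ∀ xs (p : A → Bool) c → ∑ xs (λ x → 𝟙 (p x) * c) ≡ fromℕ (count p xs) * c
  ∑-𝟙* []       p c = ≡.sym (ℚ.*-zeroˡ c)
  ∑-𝟙* (x ∷ xs) p c with p x
  ... | true  = begin
    1ℚ * c + ∑ xs (λ x → 𝟙 (p x) * c)     ≡⟨ cong₂ _+_ (ℚ.*-identityˡ c) (∑-𝟙* xs p c) ⟩
    c + fromℕ (count p xs) * c              ≡⟨ regroup c (fromℕ (count p xs)) ⟩
    (1ℚ + fromℕ (count p xs)) * c           ≡⟨ cong (_* c) (fromℕ-suc (count p xs)) ⟨
    fromℕ (suc (count p xs)) * c            ∎
    where
      open ≡-Reasoning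
      regroup : ∀ c m → c + m * c ≡ (1ℚ + m) * c
      regroup = solve-∀ ℚ-ring
  ... | false = trans (cong₂ _+_ (ℚ.*-zeroˡ c) (∑-𝟙* xs p c)) (ℚ.+-identityˡ _)

  count-cong : ∀ {p q : A → Bool} → (∀ x → p x ≡ q x) → ∀ xs → count p xs ≡ count q xs
  count-cong p≗q xs = cong length
    (List.filter-≐ (T? ∘ _) (T? ∘ _) ((λ {x} → subst T (p≗q x)) , (λ {x} → subst T (≡.sym (p≗q x)))) xs)

  count-+-count-not : ∀ p xs → count p xs ℕ.+ count (not ∘ p) xs ≡ length xs
  count-+-count-not p []       = refl
  count-+-count-not p (x ∷ xs) with p x
  ... | true  = cong suc (count-+-count-not p xs)
  ... | false = trans (ℕ.+-suc _ _) (cong suc (count-+-count-not p xs))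

  count-not-∧ : ∀ p q xs →
    count (λ x → not (p x ∧ q x)) xs ℕ.≤ count (not ∘ p) xs ℕ.+ count (not ∘ q) xs
  count-not-∧ p q []       = z≤n
  count-not-∧ p q (x ∷ xs) with p x | q x
  ... | true  | true  = count-not-∧ p q xs
  ... | true  | false = ℕ.≤-trans (s≤s (count-not-∧ p q xs)) (ℕ.≤-reflexive (≡.sym (ℕ.+-suc _ _)))
  ... | false | true  = s≤s (count-not-∧ p q xs)
  ... | false | false = s≤s (ℕ.≤-trans (count-not-∧ p q xs) (ℕ.+-monoʳ-≤ _ (ℕ.n≤1+n _)))

  count-false : ∀ xs → count (λ _ → false) xs ≡ 0
  count-false []       = refl
  count-false (x ∷ xs) = count-false xs

  +∑-+∑ : ∀ m xs (f g : A → ℚ) → (m + ∑ xs f) + ∑ xs g ≡ m + ∑ xs (λ x → f x + g x)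
  +∑-+∑ m xs f g = trans (ℚ.+-assoc m (∑ xs f) (∑ xs g)) (cong (_+_ m) (≡.sym (∑-distrib-+ xs f g)))

  ∑-linear : ∀ xs c (s f₄ f₃ f₂ f₁ : A → ℚ) →
    ∑ xs s + c * (((∑ xs f₄ + ∑ xs f₃) + ∑ xs f₂) + ∑ xs f₁)
    ≡ ∑ xs (λ x → s x + c * (((f₄ x + f₃ x) + f₂ x) + f₁ x))
  ∑-linear xs c s f₄ f₃ f₂ f₁ = begin
    ∑ xs s + c * (((∑ xs f₄ + ∑ xs f₃) + ∑ xs f₂) + ∑ xs f₁)
      ≡⟨ cong (λ t → ∑ xs s + c * t) (begin
           ((∑ xs f₄ + ∑ xs f₃) + ∑ xs f₂) + ∑ xs f₁
             ≡⟨ cong (λ t → (t + ∑ xs f₂) + ∑ xs f₁) (∑-distrib-+ xs f₄ f₃) ⟨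
           (∑ xs (λ x → f₄ x + f₃ x) + ∑ xs f₂) + ∑ xs f₁
             ≡⟨ cong (_+ ∑ xs f₁) (∑-distrib-+ xs _ f₂) ⟨
           ∑ xs (λ x → (f₄ x + f₃ x) + f₂ x) + ∑ xs f₁
             ≡⟨ ∑-distrib-+ xs _ f₁ ⟨
           ∑ xs (λ x → ((f₄ x + f₃ x) + f₂ x) + f₁ x)   ∎) ⟩
    ∑ xs s + c * ∑ xs (λ x → ((f₄ x + f₃ x) + f₂ x) + f₁ x)
      ≡⟨ cong (_+_ (∑ xs s)) (*-distribˡ-∑ xs c _) ⟨
    ∑ xs s + ∑ xs (λ x → c * (((f₄ x + f₃ x) + f₂ x) + f₁ x))
      ≡⟨ ∑-distrib-+ xs s _ ⟨
    ∑ xs (λ x → s x + c * (((f₄ x + f₃ x) + f₂ x) + f₁ x))   ∎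
    where open ≡-Reasoning

∑ᶠ-suc : ∀ {n} (f : Fin (suc n) → ℚ) → ∑ (allFin (suc n)) f ≡ f zero + ∑ (allFin n) (f ∘ suc)
∑ᶠ-suc f = cong (λ xs → f zero + foldr _+_ 0ℚ xs)
  (trans (List.map-tabulate suc f) (≡.sym (List.map-tabulate (λ i → i) (f ∘ suc))))

∑ᶠ-point : ∀ {n} (x : Fin n) (f : Fin n → ℚ) →
  ∑ (allFin n) (λ v → if does (x ≟ᶠ v) then f v else 0ℚ) ≡ f x
∑ᶠ-point {suc n} zero    f = trans (∑ᶠ-suc (λ v → if does (zero ≟ᶠ v) then f v else 0ℚ))
  (trans (cong (_+_ (f zero)) (∑-zero (allFin n) (λ _ → refl))) (ℚ.+-identityʳ (f zero)))
∑ᶠ-point {suc n} (suc x) f = trans (∑ᶠ-suc (λ v → if does (suc x ≟ᶠ v) then f v else 0ℚ))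
  (trans (ℚ.+-identityˡ _) (∑ᶠ-point x (f ∘ suc)))

module _ {n : ℕ} where

  open import Data.List.Relation.Binary.Sublist.DecPropositional (_≟ᶠ_ {n}) using (_⊆?_)

  ∑ᶠ : (Fin n → ℚ) → ℚ
  ∑ᶠ = ∑ (allFin n)

  when≢ : Fin n → Fin n → ℚ → ℚ
  when≢ x v q = if does (x ≟ᶠ v) then 0ℚ else q

  ∑ᶠ-split : ∀ x (f g : Fin n → ℚ) →
    ∑ᶠ (λ v → if does (x ≟ᶠ v) then f v else g v) ≡ f x + ∑ᶠ (λ v → when≢ x v (g v))
  ∑ᶠ-split x f g = begin
    ∑ᶠ (λ v → if does (x ≟ᶠ v) then f v else g v)
      ≡⟨ ∑-cong (allFin n) (λ v → split (does (x ≟ᶠ v))) ⟩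
    ∑ᶠ (λ v → (if does (x ≟ᶠ v) then f v else 0ℚ) + when≢ x v (g v))
      ≡⟨ ∑-distrib-+ (allFin n) _ _ ⟩
    ∑ᶠ (λ v → if does (x ≟ᶠ v) then f v else 0ℚ) + ∑ᶠ (λ v → when≢ x v (g v))
      ≡⟨ cong (_+ ∑ᶠ (λ v → when≢ x v (g v))) (∑ᶠ-point x f) ⟩
    f x + ∑ᶠ (λ v → when≢ x v (g v))   ∎
    where
      open ≡-Reasoning
      split : ∀ b {p q} → (if b then p else q) ≡ (if b then p else 0ℚ) + (if b then 0ℚ else q)
      split true  = ≡.sym (ℚ.+-identityʳ _)
      split false = ≡.sym (ℚ.+-identityˡ _)

  ∑ⁿ : ℕ → (List (Fin n) → ℚ) → ℚ
  ∑ⁿ zero    g = g []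
  ∑ⁿ (suc k) g = ∑ᶠ λ v → ∑ⁿ k (g ∘ (v ∷_))

  -- The sum of g over the k-tuples that contain xs as a subsequence, split
  -- according to the leftmost embedding of xs. The length test drops the
  -- branches in which xs no longer fits, so that for concrete xs and k the
  -- unfolding consists of the genuine placements only.
  ∑⊒ : List (Fin n) → ℕ → (List (Fin n) → ℚ) → ℚ
  ∑⊒ []       k       g = ∑ⁿ k g
  ∑⊒ (x ∷ xs) zero    g = 0ℚ
  ∑⊒ (x ∷ xs) (suc k) g =
    if length xs ℕ.<ᵇ k
    then ∑⊒ xs k (g ∘ (x ∷_)) + ∑ᶠ (λ v → when≢ x v (∑⊒ (x ∷ xs) k (g ∘ (v ∷_))))
    else ∑⊒ xs k (g ∘ (x ∷_))

  ∑⊒-no-room : ∀ x xs k g → k ℕ.≤ length xs → ∑⊒ (x ∷ xs) k g ≡ 0ℚ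
  ∑⊒-no-room x xs       zero    g _ = refl
  ∑⊒-no-room x (y ∷ ys) (suc k) g (s≤s k≤∣ys∣) with length (y ∷ ys) ℕ.<ᵇ k in eq
  ... | true  = contradiction (ℕ.m≤n⇒m≤1+n k≤∣ys∣) (ℕ.<⇒≱ (ℕ.<ᵇ⇒< _ k (subst T (≡.sym eq) _)))
  ... | false = ∑⊒-no-room y ys k (g ∘ (x ∷_)) k≤∣ys∣

  ∑ⁿ-⊆ : ∀ xs k (g : List (Fin n) → ℚ) → ∑ⁿ k (λ r → if does (xs ⊆? r) then g r else 0ℚ) ≡ ∑⊒ xs k g
  ∑ⁿ-⊆ []       k       g = refl
  ∑ⁿ-⊆ (x ∷ xs) zero    g = refl
  ∑ⁿ-⊆ (x ∷ xs) (suc k) g =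
    trans (∑-cong (allFin n) step)
    (trans (∑ᶠ-split x (λ v → ∑⊒ xs k (g ∘ (v ∷_))) (λ v → ∑⊒ (x ∷ xs) k (g ∘ (v ∷_)))) prune)
    where
      step : ∀ v → ∑ⁿ k (λ r → if does ((x ∷ xs) ⊆? (v ∷ r)) then g (v ∷ r) else 0ℚ)
                 ≡ (if does (x ≟ᶠ v) then ∑⊒ xs k (g ∘ (v ∷_)) else ∑⊒ (x ∷ xs) k (g ∘ (v ∷_)))
      step v with x ≟ᶠ v
      ... | yes _ = ∑ⁿ-⊆ xs k (g ∘ (v ∷_))
      ... | no  _ = ∑ⁿ-⊆ (x ∷ xs) k (g ∘ (v ∷_))
      prune : ∑⊒ xs k (g ∘ (x ∷_)) + ∑ᶠ (λ v → when≢ x v (∑⊒ (x ∷ xs) k (g ∘ (v ∷_)))) ≡ ∑⊒ (x ∷ xs) (suc k) g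
      prune with length xs ℕ.<ᵇ k in eq
      ... | true  = refl
      ... | false = trans (cong (_+_ (∑⊒ xs k (g ∘ (x ∷_)))) (∑-zero (allFin n) vanish)) (ℚ.+-identityʳ _)
        where
          vanish : ∀ v → when≢ x v (∑⊒ (x ∷ xs) k (g ∘ (v ∷_))) ≡ 0ℚ
          vanish v = trans (cong (when≢ x v) (∑⊒-no-room x xs k _ (ℕ.≮⇒≥ (λ lt → subst T eq (ℕ.<⇒<ᵇ lt)))))
                           (if-eta (does (x ≟ᶠ v)))

all-↭ : ∀ {A : Set} (p : A → Bool) {xs ys} → xs ↭ ys → all p xs ≡ all p ys
all-↭ p xs↭ys = ↭ₛ.foldr-commMonoid (≡.setoid Bool) ∧-isCommutativeMonoid (↭⇒↭ₛ (↭.map⁺ p xs↭ys))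

shift₂ : ∀ {A : Set} (a b : A) xs ys zs → xs ++ a ∷ ys ++ b ∷ zs ↭ a ∷ b ∷ xs ++ ys ++ zs
shift₂ a b xs ys zs = ↭.trans (↭.shift a xs (ys ++ b ∷ zs)) (↭.prep a
  (subst₂ _↭_ (List.++-assoc xs ys (b ∷ zs)) (cong (b ∷_) (List.++-assoc xs ys zs)) (↭.shift b (xs ++ ys) zs)))

-- The auxiliary invℕ of Wfrom, which Defs does not export.
1/ℕ : ℕ → ℚ
1/ℕ zero    = 0ℚ
1/ℕ (suc m) = + 1 / suc m

1/ℕ-pos : ∀ {m} → 0 ℕ.< m → Positive (1/ℕ m)
1/ℕ-pos {suc m} _ = ℚ.normalize-pos 1 (suc m)

ψ-coeff : Bool → Bool → ℚ
ψ-coeff false false = + 1 / 2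
ψ-coeff true  false = -[1+ 0 ] / 6
ψ-coeff false true  = -[1+ 0 ] / 6
ψ-coeff true  true  = + 1 / 6

module _ {n : ℕ} (G : Graph n) where

  isClique-↭ : ∀ {xs ys} → xs ↭ ys → isClique G xs ≡ isClique G ys
  isClique-↭ ↭.refl          = refl
  isClique-↭ (↭.prep x p)    = cong₂ _∧_ (all-↭ (adj G x) p) (isClique-↭ p)
  isClique-↭ {x ∷ y ∷ xs} {_ ∷ _ ∷ ys} (↭.swap _ _ p) = begin
    (adj G x y ∧ all (adj G x) xs) ∧ (all (adj G y) xs ∧ isClique G xs)
      ≡⟨ interchange (adj G x y) _ _ _ ⟩
    (adj G x y ∧ all (adj G y) xs) ∧ (all (adj G x) xs ∧ isClique G xs)
      ≡⟨ cong₂ _∧_ (cong₂ _∧_ (Graph.sym G x y) (all-↭ (adj G y) p))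
                   (cong₂ _∧_ (all-↭ (adj G x) p) (isClique-↭ p)) ⟩
    (adj G y x ∧ all (adj G y) ys) ∧ (all (adj G x) ys ∧ isClique G ys)   ∎
    where open ≡-Reasoning
  isClique-↭ (↭.trans p q)   = trans (isClique-↭ p) (isClique-↭ q)

  Nsize-↭ : ∀ {xs ys} → xs ↭ ys → Nsize G xs ≡ Nsize G ys
  Nsize-↭ p = count-cong (λ w → all-↭ (λ v → adj G v w) p) (allFin n)

  Wfrom-∷ : ∀ pre v rest → Wfrom G pre (v ∷ rest) ≡ 1/ℕ (Nsize G (pre ∷ʳ v)) * Wfrom G (pre ∷ʳ v) rest
  Wfrom-∷ pre v rest with Nsize G (pre ∷ʳ v)
  ... | zero  = refl
  ... | suc _ = refl

  Wfrom-↭ : ∀ {pre pre′} → pre ↭ pre′ → ∀ rest → Wfrom G pre rest ≡ Wfrom G pre′ rest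
  Wfrom-∷-↭ : ∀ {pre pre′ v v′} → pre ∷ʳ v ↭ pre′ ∷ʳ v′ → ∀ rest →
    Wfrom G pre (v ∷ rest) ≡ Wfrom G pre′ (v′ ∷ rest)

  Wfrom-↭ p []         = refl
  Wfrom-↭ p (v ∷ rest) = Wfrom-∷-↭ (↭.++⁺ʳ [ v ] p) rest

  Wfrom-∷-↭ {pre} {pre′} {v} {v′} p rest = begin
    Wfrom G pre (v ∷ rest)                                  ≡⟨ Wfrom-∷ pre v rest ⟩
    1/ℕ (Nsize G (pre ∷ʳ v)) * Wfrom G (pre ∷ʳ v) rest      ≡⟨ cong₂ (λ m w → 1/ℕ m * w) (Nsize-↭ p) (Wfrom-↭ p rest) ⟩
    1/ℕ (Nsize G (pre′ ∷ʳ v′)) * Wfrom G (pre′ ∷ʳ v′) rest  ≡⟨ Wfrom-∷ pre′ v′ rest ⟨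
    Wfrom G pre′ (v′ ∷ rest)                                ∎
    where open ≡-Reasoning

  W-swap : ∀ a b rest → W G (a ∷ b ∷ rest) ≡ W G (b ∷ a ∷ rest)
  W-swap a b = Wfrom-∷-↭ {[ a ]} {[ b ]} (↭.swap a b ↭.refl)

  Wfrom-∷ʳ : ∀ pre rest v → Wfrom G pre (rest ∷ʳ v) ≡ Wfrom G pre rest * 1/ℕ (Nsize G (pre ++ (rest ∷ʳ v)))
  Wfrom-∷ʳ pre []         v = trans (Wfrom-∷ pre v []) (ℚ.*-comm (1/ℕ (Nsize G (pre ∷ʳ v))) 1ℚ)
  Wfrom-∷ʳ pre (u ∷ rest) v = begin
    Wfrom G pre ((u ∷ rest) ∷ʳ v)                                          ≡⟨ Wfrom-∷ pre u (rest ∷ʳ v) ⟩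
    1/ℕ (Nsize G (pre ∷ʳ u)) * Wfrom G (pre ∷ʳ u) (rest ∷ʳ v)
      ≡⟨ cong (_*_ (1/ℕ (Nsize G (pre ∷ʳ u)))) (Wfrom-∷ʳ (pre ∷ʳ u) rest v) ⟩
    1/ℕ (Nsize G (pre ∷ʳ u)) * (Wfrom G (pre ∷ʳ u) rest * 1/ℕ (Nsize G ((pre ∷ʳ u) ++ (rest ∷ʳ v))))
      ≡⟨ ℚ.*-assoc (1/ℕ (Nsize G (pre ∷ʳ u))) (Wfrom G (pre ∷ʳ u) rest) _ ⟨
    1/ℕ (Nsize G (pre ∷ʳ u)) * Wfrom G (pre ∷ʳ u) rest * 1/ℕ (Nsize G ((pre ∷ʳ u) ++ (rest ∷ʳ v)))
      ≡⟨ cong₂ _*_ (≡.sym (Wfrom-∷ pre u rest)) (cong (1/ℕ ∘ Nsize G) (List.++-assoc pre [ u ] (rest ∷ʳ v))) ⟩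
    Wfrom G pre (u ∷ rest) * 1/ℕ (Nsize G (pre ++ (u ∷ rest) ∷ʳ v))         ∎
    where open ≡-Reasoning

  ∑-𝟙-W∷ʳ : ∀ {S} p pre v c → (p ∷ pre) ∷ʳ v ↭ S → Nsize G S ℕ.> 0 →
    ∑ᶠ (λ w → 𝟙 (inN G S w) * (W G ((p ∷ pre) ∷ʳ v) * c)) ≡ W G (p ∷ pre) * c
  ∑-𝟙-W∷ʳ {S} p pre v c p∷pre∷ʳv↭S N>0 with Nsize G S in eq | N>0
  ... | suc m | _ = begin
    ∑ᶠ (λ w → 𝟙 (inN G S w) * (W G ((p ∷ pre) ∷ʳ v) * c))     ≡⟨ ∑-𝟙* (allFin n) (inN G S) _ ⟩
    fromℕ (Nsize G S) * (W G ((p ∷ pre) ∷ʳ v) * c)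
      ≡⟨ cong₂ (λ N w → fromℕ N * (w * c)) eq (Wfrom-∷ʳ [ p ] pre v) ⟩
    fromℕ (suc m) * (W G (p ∷ pre) * 1/ℕ (Nsize G ((p ∷ pre) ∷ʳ v)) * c)
      ≡⟨ cong (λ N → fromℕ (suc m) * (W G (p ∷ pre) * 1/ℕ N * c)) (trans (Nsize-↭ p∷pre∷ʳv↭S) eq) ⟩
    fromℕ (suc m) * (W G (p ∷ pre) * (+ 1 / suc m) * c)
      ≡⟨ regroup (fromℕ (suc m)) (+ 1 / suc m) (W G (p ∷ pre)) c ⟩
    fromℕ (suc m) * (+ 1 / suc m) * (W G (p ∷ pre) * c)       ≡⟨ cong (_* (W G (p ∷ pre) * c)) (fromℕ*1/ m) ⟩
    1ℚ * (W G (p ∷ pre) * c)                                  ≡⟨ ℚ.*-identityˡ _ ⟩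
    W G (p ∷ pre) * c                                         ∎
    where
      open ≡-Reasoning
      regroup : ∀ N I w c → N * (w * I * c) ≡ N * I * (w * c)
      regroup = solve-∀ ℚ-ring

  adj⇒≢ : ∀ {x v} → adj G x v ≡ true → does (x ≟ᶠ v) ≡ false
  adj⇒≢ {x} {v} x~v with x ≟ᶠ v
  ... | yes refl = contradiction (trans (≡.sym x~v) (irrefl G x)) λ ()
  ... | no  _    = refl

  when≢-𝟙* : ∀ {x v} b q → (b ≡ true → adj G x v ≡ true) → when≢ x v (𝟙 b * q) ≡ 𝟙 b * q
  when≢-𝟙*         true  q x~v = if-cong (adj⇒≢ (x~v refl))
  when≢-𝟙* {x} {v} false q _   =
    trans (cong (when≢ x v) (ℚ.*-zeroˡ q)) (trans (if-eta (does (x ≟ᶠ v))) (≡.sym (ℚ.*-zeroˡ q)))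

  mem-∈ : ∀ {x xs} → x ∈ xs → mem G x xs ≡ true
  mem-∈ {x} (here refl) with x ≟ᶠ x
  ... | yes _ = refl
  ... | no  x≢x = contradiction refl x≢x
  mem-∈ {x} {y ∷ _} (there x∈xs) = trans (cong (does (x ≟ᶠ y) ∨_) (mem-∈ x∈xs)) (∨-zeroʳ _)

  all-adj⇒mem-false : ∀ a xs → all (adj G a) xs ≡ true → mem G a xs ≡ false
  all-adj⇒mem-false a []       _    = refl
  all-adj⇒mem-false a (x ∷ xs) a~xs =
    cong₂ _∨_ (adj⇒≢ (∧-conicalˡ _ _ a~xs)) (all-adj⇒mem-false a xs (∧-conicalʳ _ _ a~xs))

  all-mem : ∀ {K} T → (∀ {t} → t ∈ T → t ∈ K) → all (λ t → mem G t K) T ≡ true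
  all-mem []      _    = refl
  all-mem (t ∷ T) T⊆K = cong₂ _∧_ (mem-∈ (T⊆K (here refl))) (all-mem T (T⊆K ∘ there))

  all-adj≡inN : ∀ a xs → all (adj G a) xs ≡ inN G xs a
  all-adj≡inN a []       = refl
  all-adj≡inN a (x ∷ xs) = cong₂ _∧_ (Graph.sym G a x) (all-adj≡inN a xs)

  inN⇒adj : ∀ {S b x} → inN G S b ≡ true → x ∈ S → adj G x b ≡ true
  inN⇒adj b∈N (here refl)  = ∧-conicalˡ _ _ b∈N
  inN⇒adj b∈N (there x∈S) = inN⇒adj (∧-conicalʳ _ _ b∈N) x∈S

  ψ-⊆ : ∀ K a b T → all (λ t → mem G t K) T ≡ true → adj G a b ≡ true →
    ψ G K a b T ≡ ψ-coeff (mem G a T) (mem G b T)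
  ψ-⊆ K a b T T⊆K a~b rewrite T⊆K with mem G a T | mem G b T
  ... | false | false = refl
  ... | true  | false = refl
  ... | false | true  = refl
  ... | true  | true  rewrite a~b = refl

module _ {n : ℕ} (G : Graph n) (δ>4n/5 : MinDegGt45 G) where

  5*non-adjacent<n : ∀ v → 5 ℕ.* count (not ∘ adj G v) (allFin n) ℕ.< n
  5*non-adjacent<n v = ℕ.+-cancelˡ-< (4 ℕ.* n) _ _ (begin-strict
    4 ℕ.* n ℕ.+ 5 ℕ.* e              <⟨ ℕ.+-monoˡ-< (5 ℕ.* e) (δ>4n/5 v) ⟩
    5 ℕ.* d ℕ.+ 5 ℕ.* e              ≡⟨ split d e ⟩
    4 ℕ.* (d ℕ.+ e) ℕ.+ (d ℕ.+ e)    ≡⟨ cong (λ m → 4 ℕ.* m ℕ.+ m) d+e≡n ⟩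
    4 ℕ.* n ℕ.+ n                    ∎)
    where
      open ℕ.≤-Reasoning
      d = deg G v
      e = count (not ∘ adj G v) (allFin n)
      d+e≡n : d ℕ.+ e ≡ n
      d+e≡n = trans (count-+-count-not (adj G v) (allFin n)) (List.length-tabulate (λ i → i))
      split : ∀ d e → 5 ℕ.* d ℕ.+ 5 ℕ.* e ≡ 4 ℕ.* (d ℕ.+ e) ℕ.+ (d ℕ.+ e)
      split = solve-∀ℕ

  5*non-common+∣S∣≤∣S∣*n : ∀ S → 5 ℕ.* count (not ∘ inN G S) (allFin n) ℕ.+ length S ℕ.≤ length S ℕ.* n
  5*non-common+∣S∣≤∣S∣*n []      = ℕ.≤-reflexive (cong (λ c → 5 ℕ.* c ℕ.+ 0) (count-false (allFin n)))
  5*non-common+∣S∣≤∣S∣*n (v ∷ S) = begin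
    5 ℕ.* count (not ∘ inN G (v ∷ S)) (allFin n) ℕ.+ suc (length S)
      ≤⟨ ℕ.+-monoˡ-≤ (suc (length S)) (ℕ.*-monoʳ-≤ 5 (count-not-∧ (adj G v) (inN G S) (allFin n))) ⟩
    5 ℕ.* (a ℕ.+ b) ℕ.+ suc (length S)         ≡⟨ regroup a b (length S) ⟩
    suc (5 ℕ.* a) ℕ.+ (5 ℕ.* b ℕ.+ length S)   ≤⟨ ℕ.+-mono-≤ (5*non-adjacent<n v) (5*non-common+∣S∣≤∣S∣*n S) ⟩
    n ℕ.+ length S ℕ.* n                        ∎
    where
      open ℕ.≤-Reasoning
      a = count (not ∘ adj G v) (allFin n)
      b = count (not ∘ inN G S) (allFin n)
      regroup : ∀ a b l → 5 ℕ.* (a ℕ.+ b) ℕ.+ suc l ≡ suc (5 ℕ.* a) ℕ.+ (5 ℕ.* b ℕ.+ l)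
      regroup = solve-∀ℕ

  Nsize>0 : ∀ S → 0 ℕ.< length S → length S ℕ.≤ 5 → 0 ℕ.< Nsize G S
  Nsize>0 S 0<∣S∣ ∣S∣≤5 with Nsize G S in eq
  ... | suc _ = s≤s z≤n
  ... | zero  = contradiction (ℕ.+-cancelˡ-≤ (5 ℕ.* n) _ 0 (begin
    5 ℕ.* n ℕ.+ length S                                      ≡⟨ cong (λ c → 5 ℕ.* c ℕ.+ length S) non-common≡n ⟨
    5 ℕ.* count (not ∘ inN G S) (allFin n) ℕ.+ length S       ≤⟨ 5*non-common+∣S∣≤∣S∣*n S ⟩
    length S ℕ.* n                                            ≤⟨ ℕ.*-monoˡ-≤ n ∣S∣≤5 ⟩
    5 ℕ.* n                                                   ≡⟨ ℕ.+-identityʳ _ ⟨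
    5 ℕ.* n ℕ.+ 0                                             ∎)) (ℕ.<⇒≱ 0<∣S∣)
    where
      open ℕ.≤-Reasoning
      non-common≡n : count (not ∘ inN G S) (allFin n) ≡ n
      non-common≡n = trans (cong (ℕ._+ count (not ∘ inN G S) (allFin n)) (≡.sym eq))
                           (trans (count-+-count-not (inN G S) (allFin n)) (List.length-tabulate (λ i → i)))

  Wfrom-pos : ∀ pre rest → 0 ℕ.< length pre → length (pre ++ rest) ℕ.≤ 5 → Positive (Wfrom G pre rest)
  Wfrom-pos pre []         _      _  = _
  Wfrom-pos pre (v ∷ rest) 0<∣pre∣ ≤5 = subst Positive (≡.sym (Wfrom-∷ G pre v rest))
    (ℚ.pos*pos⇒pos (1/ℕ (Nsize G (pre ∷ʳ v))) {{1/ℕ-pos (Nsize>0 (pre ∷ʳ v) 0<∣pre∷ʳv∣ ∣pre∷ʳv∣≤5)}}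
                   (Wfrom G (pre ∷ʳ v) rest) {{Wfrom-pos (pre ∷ʳ v) rest 0<∣pre∷ʳv∣ ≤5′}})
    where
      ≤5′ : length ((pre ∷ʳ v) ++ rest) ℕ.≤ 5
      ≤5′ = subst (λ l → length l ℕ.≤ 5) (≡.sym (List.++-assoc pre [ v ] rest)) ≤5
      ∣pre∷ʳv∣≤5 : length (pre ∷ʳ v) ℕ.≤ 5
      ∣pre∷ʳv∣≤5 = ℕ.≤-trans (List.length-++-≤ˡ (pre ∷ʳ v)) ≤5′
      0<∣pre∷ʳv∣ : 0 ℕ.< length (pre ∷ʳ v)
      0<∣pre∷ʳv∣ = ℕ.<-≤-trans 0<∣pre∣ (List.length-++-≤ˡ pre)

  W-pos : ∀ vs → length vs ℕ.≤ 5 → Positive (W G vs)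
  W-pos []       _  = _
  W-pos (v ∷ vs) ≤5 = Wfrom-pos [ v ] vs (s≤s z≤n) ≤5

module Lemma2p4 {n : ℕ} (G : Graph n) (δ>4n/5 : MinDegGt45 G)
                (x₁ x₂ x₃ x₄ : Fin n) (O-clique : OK G (x₁ ∷ x₂ ∷ x₃ ∷ x₄ ∷ [])) where

  open import Data.List.Relation.Binary.Sublist.DecPropositional (_≟ᶠ_ {n}) using (_⊆?_)

  O : List (Fin n)
  O = x₁ ∷ x₂ ∷ x₃ ∷ x₄ ∷ []

  R : Fin n → Bool
  R = inN G O

  cl : Fin n → Fin n → Bool
  cl a b = isClique G (a ∷ b ∷ O)

  cl≡ : ∀ a b → cl a b ≡ R a ∧ inN G (a ∷ O) b
  cl≡ a b rewrite all-adj≡inN G a O | all-adj≡inN G b O | T-≡ .Equivalence.to O-clique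
    = regroup (adj G a b) (R a) (R b)
    where
      regroup : ∀ e r s → (e ∧ r) ∧ (s ∧ true) ≡ r ∧ (e ∧ s)
      regroup false false s = refl
      regroup false true  s = refl
      regroup true  false s = refl
      regroup true  true  s = ∧-identityʳ s

  𝟙-cl : ∀ a b → 𝟙 (cl a b) ≡ 𝟙 (R a) * 𝟙 (inN G (a ∷ O) b)
  𝟙-cl a b = trans (cong 𝟙 (cl≡ a b)) (𝟙-∧ (R a) _)

  cl⇒R₁ : ∀ {a b} → cl a b ≡ true → R a ≡ true
  cl⇒R₁ {a} {b} c = ∧-conicalˡ _ _ (trans (≡.sym (cl≡ a b)) c)

  cl⇒R₂ : ∀ {a b} → cl a b ≡ true → R b ≡ true
  cl⇒R₂ {a} {b} c = ∧-conicalʳ (adj G a b) _ (∧-conicalʳ (R a) _ (trans (≡.sym (cl≡ a b)) c))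

  R⇒∉O : ∀ {a} → R a ≡ true → mem G a O ≡ false
  R⇒∉O {a} r = all-adj⇒mem-false G a O (trans (all-adj≡inN G a O) r)

  x₁∈O : x₁ ∈ O
  x₁∈O = here refl

  x₂∈O : x₂ ∈ O
  x₂∈O = there (here refl)

  x₃∈O : x₃ ∈ O
  x₃∈O = there (there (here refl))

  x₄∈O : x₄ ∈ O
  x₄∈O = there (there (there (here refl)))

  term : List (Fin n) → ℚ
  term K@(v₁ ∷ v₂ ∷ v₃ ∷ v₄ ∷ v₅ ∷ _ ∷ []) =
    if isClique G K then W G (v₁ ∷ v₂ ∷ v₃ ∷ v₄ ∷ v₅ ∷ []) * ψ G K v₁ v₂ O else 0ℚ
  term _ = 0ℚ

  WG≡∑⊒ : WG G O ≡ (+ 1 / 2) * ∑⊒ O 6 term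
  WG≡∑⊒ = cong (_*_ (+ 1 / 2)) (trans
    (∑-cong (allFin n) λ v₁ → ∑-cong (allFin n) λ v₂ → ∑-cong (allFin n) λ v₃ →
     ∑-cong (allFin n) λ v₄ → ∑-cong (allFin n) λ v₅ → ∑-cong (allFin n) λ v₆ →
       let K = v₁ ∷ v₂ ∷ v₃ ∷ v₄ ∷ v₅ ∷ v₆ ∷ [] in
       trans (if-cong (∧-comm (isClique G K) (does (O ⊆? K)))) (if-∧ (does (O ⊆? K))))
    (∑ⁿ-⊆ O 6 term))

  term-↭ : ∀ {a b v₁ v₂ v₃ v₄ v₅ v₆ m₁ m₂} → v₁ ∷ v₂ ∷ v₃ ∷ v₄ ∷ v₅ ∷ v₆ ∷ [] ↭ a ∷ b ∷ O →
    (cl a b ≡ true → mem G v₁ O ≡ m₁ × mem G v₂ O ≡ m₂) →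
    term (v₁ ∷ v₂ ∷ v₃ ∷ v₄ ∷ v₅ ∷ v₆ ∷ []) ≡ 𝟙 (cl a b) * (W G (v₁ ∷ v₂ ∷ v₃ ∷ v₄ ∷ v₅ ∷ []) * ψ-coeff m₁ m₂)
  term-↭ {a} {b} {v₁} {v₂} {v₃} {v₄} {v₅} {v₆} {m₁} {m₂} K↭abO mems = begin
    term K                                   ≡⟨ if-then-0≡𝟙* (isClique G K) _ ⟩
    𝟙 (isClique G K) * (W₅ * ψ G K v₁ v₂ O)  ≡⟨ cong (λ c → 𝟙 c * (W₅ * ψ G K v₁ v₂ O)) (isClique-↭ G K↭abO) ⟩
    𝟙 (cl a b) * (W₅ * ψ G K v₁ v₂ O)        ≡⟨ 𝟙*-cong (cl a b) (cong (_*_ W₅) ∘ ψ-value) ⟩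
    𝟙 (cl a b) * (W₅ * ψ-coeff m₁ m₂)        ∎
    where
      open ≡-Reasoning
      K = v₁ ∷ v₂ ∷ v₃ ∷ v₄ ∷ v₅ ∷ v₆ ∷ []
      W₅ = W G (v₁ ∷ v₂ ∷ v₃ ∷ v₄ ∷ v₅ ∷ [])
      O⊆K : ∀ {t} → t ∈ O → t ∈ K
      O⊆K t∈O = ↭.∈-resp-↭ (↭.↭-sym K↭abO) (there (there t∈O))
      ψ-value : cl a b ≡ true → ψ G K v₁ v₂ O ≡ ψ-coeff m₁ m₂
      ψ-value c = trans (ψ-⊆ G K v₁ v₂ O (all-mem G O O⊆K) v₁~v₂) (cong₂ ψ-coeff (proj₁ (mems c)) (proj₂ (mems c)))
        where
          v₁~v₂ : adj G v₁ v₂ ≡ true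
          v₁~v₂ = ∧-conicalˡ _ _ (∧-conicalˡ _ _ (trans (isClique-↭ G K↭abO) c))

  when≢-cl : ∀ {x a b} q → x ∈ O → when≢ x b (𝟙 (cl a b) * q) ≡ 𝟙 (cl a b) * q
  when≢-cl q x∈O = when≢-𝟙* G _ q (λ c → inN⇒adj G (cl⇒R₂ c) x∈O)

  when≢-term-↭ : ∀ {x a b v₁ v₂ v₃ v₄ v₅ v₆ m₁ m₂} → x ∈ O → v₁ ∷ v₂ ∷ v₃ ∷ v₄ ∷ v₅ ∷ v₆ ∷ [] ↭ a ∷ b ∷ O →
    (cl a b ≡ true → mem G v₁ O ≡ m₁ × mem G v₂ O ≡ m₂) →
    when≢ x b (term (v₁ ∷ v₂ ∷ v₃ ∷ v₄ ∷ v₅ ∷ v₆ ∷ []))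
    ≡ 𝟙 (cl a b) * (W G (v₁ ∷ v₂ ∷ v₃ ∷ v₄ ∷ v₅ ∷ []) * ψ-coeff m₁ m₂)
  when≢-term-↭ {x} {a} {b} x∈O K↭abO mems = trans (cong (when≢ x b) (term-↭ K↭abO mems)) (when≢-cl _ x∈O)

  in-in : ∀ {a b} → cl a b ≡ true → mem G x₁ O ≡ true × mem G x₂ O ≡ true
  in-in _ = mem-∈ G x₁∈O , mem-∈ G x₂∈O

  in-out : ∀ {a b} → cl a b ≡ true → mem G x₁ O ≡ true × mem G a O ≡ false
  in-out c = mem-∈ G x₁∈O , R⇒∉O (cl⇒R₁ c)

  out-in : ∀ {a b} → cl a b ≡ true → mem G a O ≡ false × mem G x₁ O ≡ true
  out-in c = R⇒∉O (cl⇒R₁ c) , mem-∈ G x₁∈O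

  out-out : ∀ {a b} → cl a b ≡ true → mem G a O ≡ false × mem G b O ≡ false
  out-out c = R⇒∉O (cl⇒R₁ c) , R⇒∉O (cl⇒R₂ c)

  𝟙*W-swap : ∀ c a rest k → 𝟙 c * (W G (a ∷ x₁ ∷ rest) * k) ≡ 𝟙 c * (W G (x₁ ∷ a ∷ rest) * k)
  𝟙*W-swap c a rest k = cong (λ w → 𝟙 c * (w * k)) (W-swap G a x₁ rest)

  -- tᵢⱼ a b is the summand of ∑⊒ O 6 term with a, b at positions i < j; the
  -- guard when≢ stems from the leftmost-embedding split.
  t₅₆ t₄₆ t₄₅ t₃₆ t₃₅ t₃₄ t₂₆ t₂₅ t₂₄ t₂₃ t₁₆ t₁₅ t₁₄ t₁₃ t₁₂ : Fin n → Fin n → ℚ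
  t₅₆ a b = term (x₁ ∷ x₂ ∷ x₃ ∷ x₄ ∷ a ∷ b ∷ [])
  t₄₆ a b = term (x₁ ∷ x₂ ∷ x₃ ∷ a ∷ x₄ ∷ b ∷ [])
  t₄₅ a b = when≢ x₄ b (term (x₁ ∷ x₂ ∷ x₃ ∷ a ∷ b ∷ x₄ ∷ []))
  t₃₆ a b = term (x₁ ∷ x₂ ∷ a ∷ x₃ ∷ x₄ ∷ b ∷ [])
  t₃₅ a b = when≢ x₄ b (term (x₁ ∷ x₂ ∷ a ∷ x₃ ∷ b ∷ x₄ ∷ []))
  t₃₄ a b = when≢ x₃ b (term (x₁ ∷ x₂ ∷ a ∷ b ∷ x₃ ∷ x₄ ∷ []))
  t₂₆ a b = term (x₁ ∷ a ∷ x₂ ∷ x₃ ∷ x₄ ∷ b ∷ [])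
  t₂₅ a b = when≢ x₄ b (term (x₁ ∷ a ∷ x₂ ∷ x₃ ∷ b ∷ x₄ ∷ []))
  t₂₄ a b = when≢ x₃ b (term (x₁ ∷ a ∷ x₂ ∷ b ∷ x₃ ∷ x₄ ∷ []))
  t₂₃ a b = when≢ x₂ b (term (x₁ ∷ a ∷ b ∷ x₂ ∷ x₃ ∷ x₄ ∷ []))
  t₁₆ a b = term (a ∷ x₁ ∷ x₂ ∷ x₃ ∷ x₄ ∷ b ∷ [])
  t₁₅ a b = when≢ x₄ b (term (a ∷ x₁ ∷ x₂ ∷ x₃ ∷ b ∷ x₄ ∷ []))
  t₁₄ a b = when≢ x₃ b (term (a ∷ x₁ ∷ x₂ ∷ b ∷ x₃ ∷ x₄ ∷ []))
  t₁₃ a b = when≢ x₂ b (term (a ∷ x₁ ∷ b ∷ x₂ ∷ x₃ ∷ x₄ ∷ []))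
  t₁₂ a b = when≢ x₁ b (term (a ∷ b ∷ x₁ ∷ x₂ ∷ x₃ ∷ x₄ ∷ []))

  T₅₆ : ℚ
  T₅₆ = ∑ᶠ λ a → ∑ᶠ (t₅₆ a)

  P₄ P₃ P₂ P₁ : Fin n → ℚ
  P₄ a = ∑ᶠ (t₄₆ a) + ∑ᶠ (t₄₅ a)
  P₃ a = (∑ᶠ (t₃₆ a) + ∑ᶠ (t₃₅ a)) + ∑ᶠ (t₃₄ a)
  P₂ a = ((∑ᶠ (t₂₆ a) + ∑ᶠ (t₂₅ a)) + ∑ᶠ (t₂₄ a)) + ∑ᶠ (t₂₃ a)
  P₁ a = (((∑ᶠ (t₁₆ a) + ∑ᶠ (t₁₅ a)) + ∑ᶠ (t₁₄ a)) + ∑ᶠ (t₁₃ a)) + ∑ᶠ (t₁₂ a)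

  ∑⊒-unfold : ∑⊒ O 6 term ≡ (((T₅₆ + ∑ᶠ (λ a → when≢ x₄ a (P₄ a))) + ∑ᶠ (λ a → when≢ x₃ a (P₃ a)))
                             + ∑ᶠ (λ a → when≢ x₂ a (P₂ a))) + ∑ᶠ (λ a → when≢ x₁ a (P₁ a))
  ∑⊒-unfold = refl

  c₁₁ c₁₀ c₀₀ : ℚ
  c₁₁ = ψ-coeff true  true
  c₁₀ = ψ-coeff true  false
  c₀₀ = ψ-coeff false false

  t₅₆≡ : ∀ a b → t₅₆ a b ≡ 𝟙 (cl a b) * (W G (x₁ ∷ x₂ ∷ x₃ ∷ x₄ ∷ a ∷ []) * c₁₁)
  t₅₆≡ a b = term-↭ (shift₂ a b O [] []) in-in
  t₄₆≡ : ∀ a b → t₄₆ a b ≡ 𝟙 (cl a b) * (W G (x₁ ∷ x₂ ∷ x₃ ∷ a ∷ x₄ ∷ []) * c₁₁)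
  t₄₆≡ a b = term-↭ (shift₂ a b (x₁ ∷ x₂ ∷ x₃ ∷ []) (x₄ ∷ []) []) in-in
  t₄₅≡ : ∀ a b → t₄₅ a b ≡ 𝟙 (cl a b) * (W G (x₁ ∷ x₂ ∷ x₃ ∷ a ∷ b ∷ []) * c₁₁)
  t₄₅≡ a b = when≢-term-↭ x₄∈O (shift₂ a b (x₁ ∷ x₂ ∷ x₃ ∷ []) [] (x₄ ∷ [])) in-in
  t₃₆≡ : ∀ a b → t₃₆ a b ≡ 𝟙 (cl a b) * (W G (x₁ ∷ x₂ ∷ a ∷ x₃ ∷ x₄ ∷ []) * c₁₁)
  t₃₆≡ a b = term-↭ (shift₂ a b (x₁ ∷ x₂ ∷ []) (x₃ ∷ x₄ ∷ []) []) in-in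
  t₃₅≡ : ∀ a b → t₃₅ a b ≡ 𝟙 (cl a b) * (W G (x₁ ∷ x₂ ∷ a ∷ x₃ ∷ b ∷ []) * c₁₁)
  t₃₅≡ a b = when≢-term-↭ x₄∈O (shift₂ a b (x₁ ∷ x₂ ∷ []) (x₃ ∷ []) (x₄ ∷ [])) in-in
  t₃₄≡ : ∀ a b → t₃₄ a b ≡ 𝟙 (cl a b) * (W G (x₁ ∷ x₂ ∷ a ∷ b ∷ x₃ ∷ []) * c₁₁)
  t₃₄≡ a b = when≢-term-↭ x₃∈O (shift₂ a b (x₁ ∷ x₂ ∷ []) [] (x₃ ∷ x₄ ∷ [])) in-in
  t₂₆≡ : ∀ a b → t₂₆ a b ≡ 𝟙 (cl a b) * (W G (x₁ ∷ a ∷ x₂ ∷ x₃ ∷ x₄ ∷ []) * c₁₀)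
  t₂₆≡ a b = term-↭ (shift₂ a b (x₁ ∷ []) (x₂ ∷ x₃ ∷ x₄ ∷ []) []) in-out
  t₂₅≡ : ∀ a b → t₂₅ a b ≡ 𝟙 (cl a b) * (W G (x₁ ∷ a ∷ x₂ ∷ x₃ ∷ b ∷ []) * c₁₀)
  t₂₅≡ a b = when≢-term-↭ x₄∈O (shift₂ a b (x₁ ∷ []) (x₂ ∷ x₃ ∷ []) (x₄ ∷ [])) in-out
  t₂₄≡ : ∀ a b → t₂₄ a b ≡ 𝟙 (cl a b) * (W G (x₁ ∷ a ∷ x₂ ∷ b ∷ x₃ ∷ []) * c₁₀)
  t₂₄≡ a b = when≢-term-↭ x₃∈O (shift₂ a b (x₁ ∷ []) (x₂ ∷ []) (x₃ ∷ x₄ ∷ [])) in-out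
  t₂₃≡ : ∀ a b → t₂₃ a b ≡ 𝟙 (cl a b) * (W G (x₁ ∷ a ∷ b ∷ x₂ ∷ x₃ ∷ []) * c₁₀)
  t₂₃≡ a b = when≢-term-↭ x₂∈O (shift₂ a b (x₁ ∷ []) [] (x₂ ∷ x₃ ∷ x₄ ∷ [])) in-out
  t₁₆≡ : ∀ a b → t₁₆ a b ≡ 𝟙 (cl a b) * (W G (x₁ ∷ a ∷ x₂ ∷ x₃ ∷ x₄ ∷ []) * c₁₀)
  t₁₆≡ a b = trans (term-↭ (shift₂ a b [] O []) out-in) (𝟙*W-swap (cl a b) a (x₂ ∷ x₃ ∷ x₄ ∷ []) c₁₀)
  t₁₅≡ : ∀ a b → t₁₅ a b ≡ 𝟙 (cl a b) * (W G (x₁ ∷ a ∷ x₂ ∷ x₃ ∷ b ∷ []) * c₁₀)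
  t₁₅≡ a b = trans (when≢-term-↭ x₄∈O (shift₂ a b [] (x₁ ∷ x₂ ∷ x₃ ∷ []) (x₄ ∷ [])) out-in)
                   (𝟙*W-swap (cl a b) a (x₂ ∷ x₃ ∷ b ∷ []) c₁₀)
  t₁₄≡ : ∀ a b → t₁₄ a b ≡ 𝟙 (cl a b) * (W G (x₁ ∷ a ∷ x₂ ∷ b ∷ x₃ ∷ []) * c₁₀)
  t₁₄≡ a b = trans (when≢-term-↭ x₃∈O (shift₂ a b [] (x₁ ∷ x₂ ∷ []) (x₃ ∷ x₄ ∷ [])) out-in)
                   (𝟙*W-swap (cl a b) a (x₂ ∷ b ∷ x₃ ∷ []) c₁₀)
  t₁₃≡ : ∀ a b → t₁₃ a b ≡ 𝟙 (cl a b) * (W G (x₁ ∷ a ∷ b ∷ x₂ ∷ x₃ ∷ []) * c₁₀)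
  t₁₃≡ a b = trans (when≢-term-↭ x₂∈O (shift₂ a b [] (x₁ ∷ []) (x₂ ∷ x₃ ∷ x₄ ∷ [])) out-in)
                   (𝟙*W-swap (cl a b) a (b ∷ x₂ ∷ x₃ ∷ []) c₁₀)
  t₁₂≡ : ∀ a b → t₁₂ a b ≡ 𝟙 (cl a b) * (W G (a ∷ b ∷ x₁ ∷ x₂ ∷ x₃ ∷ []) * c₀₀)
  t₁₂≡ a b = when≢-term-↭ x₁∈O (shift₂ a b [] [] O) out-out

  ∑-cl : ∀ a (f Y : Fin n → ℚ) → (∀ b → f b ≡ 𝟙 (cl a b) * Y b) →
    ∑ᶠ f ≡ 𝟙 (R a) * ∑ᶠ (λ b → 𝟙 (inN G (a ∷ O) b) * Y b)
  ∑-cl a f Y f≡ = begin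
    ∑ᶠ f                                                ≡⟨ ∑-cong (allFin n) split ⟩
    ∑ᶠ (λ b → 𝟙 (R a) * (𝟙 (inN G (a ∷ O) b) * Y b))  ≡⟨ *-distribˡ-∑ (allFin n) (𝟙 (R a)) _ ⟩
    𝟙 (R a) * ∑ᶠ (λ b → 𝟙 (inN G (a ∷ O) b) * Y b)    ∎
    where
      open ≡-Reasoning
      split : ∀ b → f b ≡ 𝟙 (R a) * (𝟙 (inN G (a ∷ O) b) * Y b)
      split b = trans (f≡ b) (trans (cong (_* Y b) (𝟙-cl a b)) (ℚ.*-assoc (𝟙 (R a)) (𝟙 (inN G (a ∷ O) b)) (Y b)))

  ∑-collapse : ∀ {a} (f : Fin n → ℚ) p pre v c → (p ∷ pre) ∷ʳ v ↭ a ∷ O →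
    (∀ b → f b ≡ 𝟙 (cl a b) * (W G ((p ∷ pre) ∷ʳ v) * c)) → ∑ᶠ f ≡ 𝟙 (R a) * (W G (p ∷ pre) * c)
  ∑-collapse {a} f p pre v c perm f≡ = trans (∑-cl a f _ f≡)
    (cong (_*_ (𝟙 (R a))) (∑-𝟙-W∷ʳ G p pre v c perm (Nsize>0 G δ>4n/5 (a ∷ O) (s≤s z≤n) ℕ.≤-refl)))

  ∑-collapse+∑-cl : ∀ a {m} (f h Y : Fin n → ℚ) → ∑ᶠ f ≡ 𝟙 (R a) * m → (∀ b → h b ≡ 𝟙 (cl a b) * Y b) →
    ∑ᶠ f + ∑ᶠ h ≡ 𝟙 (R a) * (m + ∑ᶠ (λ b → 𝟙 (inN G (a ∷ O) b) * Y b))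
  ∑-collapse+∑-cl a f h Y ∑f≡ h≡ = trans (cong₂ _+_ ∑f≡ (∑-cl a h Y h≡)) (≡.sym (ℚ.*-distribˡ-+ (𝟙 (R a)) _ _))

  -- With a at position k, summing out b in tₖ₆ yields Mₖ a, and the other
  -- tₖⱼ contribute Yₖ a b.
  M₄ M₃ M₂ M₁ : Fin n → ℚ
  M₄ a = W G (x₁ ∷ x₂ ∷ x₃ ∷ a ∷ []) * c₁₁
  M₃ a = W G (x₁ ∷ x₂ ∷ a ∷ x₃ ∷ []) * c₁₁
  M₂ a = W G (x₁ ∷ a ∷ x₂ ∷ x₃ ∷ []) * c₁₀
  M₁ a = W G (x₁ ∷ a ∷ x₂ ∷ x₃ ∷ []) * c₁₀

  Y₄ Y₃ Y₂ Y₁ : Fin n → Fin n → ℚ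
  Y₄ a b = W G (x₁ ∷ x₂ ∷ x₃ ∷ a ∷ b ∷ []) * c₁₁
  Y₃ a b = W G (x₁ ∷ x₂ ∷ a ∷ x₃ ∷ b ∷ []) * c₁₁ + W G (x₁ ∷ x₂ ∷ a ∷ b ∷ x₃ ∷ []) * c₁₁
  Y₂ a b = (W G (x₁ ∷ a ∷ x₂ ∷ x₃ ∷ b ∷ []) * c₁₀ + W G (x₁ ∷ a ∷ x₂ ∷ b ∷ x₃ ∷ []) * c₁₀)
         + W G (x₁ ∷ a ∷ b ∷ x₂ ∷ x₃ ∷ []) * c₁₀
  Y₁ a b = Y₂ a b + W G (a ∷ b ∷ x₁ ∷ x₂ ∷ x₃ ∷ []) * c₀₀

  P₄-value : ∀ a → P₄ a ≡ 𝟙 (R a) * (M₄ a + ∑ᶠ (λ b → 𝟙 (inN G (a ∷ O) b) * Y₄ a b))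
  P₄-value a = ∑-collapse+∑-cl a (t₄₆ a) (t₄₅ a) (Y₄ a)
    (∑-collapse (t₄₆ a) x₁ (x₂ ∷ x₃ ∷ a ∷ []) x₄ c₁₁ (↭.shift a (x₁ ∷ x₂ ∷ x₃ ∷ []) (x₄ ∷ [])) (t₄₆≡ a))
    (t₄₅≡ a)

  P₃-value : ∀ a → P₃ a ≡ 𝟙 (R a) * (M₃ a + ∑ᶠ (λ b → 𝟙 (inN G (a ∷ O) b) * Y₃ a b))
  P₃-value a = trans (+∑-+∑ (∑ᶠ (t₃₆ a)) (allFin n) (t₃₅ a) (t₃₄ a)) (∑-collapse+∑-cl a (t₃₆ a) _ (Y₃ a)
    (∑-collapse (t₃₆ a) x₁ (x₂ ∷ a ∷ x₃ ∷ []) x₄ c₁₁ (↭.shift a (x₁ ∷ x₂ ∷ []) (x₃ ∷ x₄ ∷ [])) (t₃₆≡ a))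
    (λ b → trans (cong₂ _+_ (t₃₅≡ a b) (t₃₄≡ a b)) (≡.sym (ℚ.*-distribˡ-+ (𝟙 (cl a b)) _ _))))

  P₂-value : ∀ a → P₂ a ≡ 𝟙 (R a) * (M₂ a + ∑ᶠ (λ b → 𝟙 (inN G (a ∷ O) b) * Y₂ a b))
  P₂-value a = trans merge (∑-collapse+∑-cl a (t₂₆ a) _ (Y₂ a)
    (∑-collapse (t₂₆ a) x₁ (a ∷ x₂ ∷ x₃ ∷ []) x₄ c₁₀ (↭.shift a (x₁ ∷ []) (x₂ ∷ x₃ ∷ x₄ ∷ [])) (t₂₆≡ a))
    (λ b → trans (cong₂ _+_ (cong₂ _+_ (t₂₅≡ a b) (t₂₄≡ a b)) (t₂₃≡ a b)) (≡.sym (*-distribˡ-+₃ (𝟙 (cl a b)) _ _ _))))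
    where
      merge = trans (cong (_+ ∑ᶠ (t₂₃ a)) (+∑-+∑ (∑ᶠ (t₂₆ a)) (allFin n) (t₂₅ a) (t₂₄ a)))
                    (+∑-+∑ (∑ᶠ (t₂₆ a)) (allFin n) _ (t₂₃ a))

  P₁-value : ∀ a → P₁ a ≡ 𝟙 (R a) * (M₁ a + ∑ᶠ (λ b → 𝟙 (inN G (a ∷ O) b) * Y₁ a b))
  P₁-value a = trans merge (∑-collapse+∑-cl a (t₁₆ a) _ (Y₁ a)
    (∑-collapse (t₁₆ a) x₁ (a ∷ x₂ ∷ x₃ ∷ []) x₄ c₁₀ (↭.shift a (x₁ ∷ []) (x₂ ∷ x₃ ∷ x₄ ∷ [])) (t₁₆≡ a))
    (λ b → trans (cong₂ _+_ (cong₂ _+_ (cong₂ _+_ (t₁₅≡ a b) (t₁₄≡ a b)) (t₁₃≡ a b)) (t₁₂≡ a b))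
                 (≡.sym (*-distribˡ-+₄ (𝟙 (cl a b)) _ _ _ _))))
    where
      merge = trans (cong (_+ ∑ᶠ (t₁₂ a)) (trans (cong (_+ ∑ᶠ (t₁₃ a)) (+∑-+∑ (∑ᶠ (t₁₆ a)) (allFin n) (t₁₅ a) (t₁₄ a)))
                                                  (+∑-+∑ (∑ᶠ (t₁₆ a)) (allFin n) _ (t₁₃ a))))
                    (+∑-+∑ (∑ᶠ (t₁₆ a)) (allFin n) _ (t₁₂ a))

  A : Fin n → ℚ
  A y = (+ 2 / 1) * W G (x₁ ∷ y ∷ x₂ ∷ x₃ ∷ []) - W G (x₁ ∷ x₂ ∷ x₃ ∷ y ∷ []) - W G (x₁ ∷ x₂ ∷ y ∷ x₃ ∷ [])

  B : Fin n → Fin n → ℚ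
  B y z = (+ 2 / 1) * W G (x₁ ∷ y ∷ x₂ ∷ x₃ ∷ z ∷ [])
        + (+ 2 / 1) * W G (x₁ ∷ y ∷ x₂ ∷ z ∷ x₃ ∷ [])
        + (+ 2 / 1) * W G (x₁ ∷ y ∷ z ∷ x₂ ∷ x₃ ∷ [])
        - W G (x₁ ∷ x₂ ∷ x₃ ∷ y ∷ z ∷ [])
        - W G (x₁ ∷ x₂ ∷ y ∷ x₃ ∷ z ∷ [])
        - W G (x₁ ∷ x₂ ∷ y ∷ z ∷ x₃ ∷ [])
        - (+ 3 / 1) * W G (y ∷ z ∷ x₁ ∷ x₂ ∷ x₃ ∷ [])

  summand : Fin n → ℚ
  summand y = if R y then A y + ∑ᶠ (λ z → if adj G y z ∧ inN G O z then B y z else 0ℚ) else 0ℚ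

  six : ℚ
  six = + 6 / 1

  A-cancellation : ∀ y → A y + six * (((M₄ y + M₃ y) + M₂ y) + M₁ y) ≡ 0ℚ
  A-cancellation y =
    identity (W G (x₁ ∷ y ∷ x₂ ∷ x₃ ∷ [])) (W G (x₁ ∷ x₂ ∷ x₃ ∷ y ∷ [])) (W G (x₁ ∷ x₂ ∷ y ∷ x₃ ∷ []))
    where
      identity : ∀ p q r → (+ 2 / 1) * p - q - r + six * (((q * c₁₁ + r * c₁₁) + p * c₁₀) + p * c₁₀) ≡ 0ℚ
      identity = solve-∀ ℚ-ring

  B-cancellation : ∀ y z → let e = 𝟙 (inN G (y ∷ O) z) in
    e * B y z + six * (((e * Y₄ y z + e * Y₃ y z) + e * Y₂ y z) + e * Y₁ y z) ≡ 0ℚ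
  B-cancellation y z = identity (𝟙 (inN G (y ∷ O) z))
    (W G (x₁ ∷ y ∷ x₂ ∷ x₃ ∷ z ∷ [])) (W G (x₁ ∷ y ∷ x₂ ∷ z ∷ x₃ ∷ [])) (W G (x₁ ∷ y ∷ z ∷ x₂ ∷ x₃ ∷ []))
    (W G (x₁ ∷ x₂ ∷ x₃ ∷ y ∷ z ∷ [])) (W G (x₁ ∷ x₂ ∷ y ∷ x₃ ∷ z ∷ [])) (W G (x₁ ∷ x₂ ∷ y ∷ z ∷ x₃ ∷ []))
    (W G (y ∷ z ∷ x₁ ∷ x₂ ∷ x₃ ∷ []))
    where
      identity : ∀ e p q r s t u v →
        e * ((+ 2 / 1) * p + (+ 2 / 1) * q + (+ 2 / 1) * r - s - t - u - (+ 3 / 1) * v)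
        + six * (((e * (s * c₁₁) + e * (t * c₁₁ + u * c₁₁))
                 + e * ((p * c₁₀ + q * c₁₀) + r * c₁₀))
                 + e * (((p * c₁₀ + q * c₁₀) + r * c₁₀) + v * c₀₀))
        ≡ 0ℚ
      identity = solve-∀ ℚ-ring

  summand-𝟙 : ∀ y → summand y ≡ 𝟙 (R y) * (A y + ∑ᶠ (λ z → 𝟙 (inN G (y ∷ O) z) * B y z))
  summand-𝟙 y = trans (if-then-0≡𝟙* (R y) _)
    (cong (λ s → 𝟙 (R y) * (A y + s)) (∑-cong (allFin n) (λ z → if-then-0≡𝟙* (inN G (y ∷ O) z) (B y z))))

  when≢-R : ∀ {x y} (P : ℚ) {m} → x ∈ O → P ≡ 𝟙 (R y) * m → when≢ x y P ≡ 𝟙 (R y) * m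
  when≢-R {x} {y} P x∈O P≡ = trans (cong (when≢ x y) P≡) (when≢-𝟙* G (R y) _ (λ r → inN⇒adj G r x∈O))

  summand-cancellation : ∀ y →
    summand y + six * (((when≢ x₄ y (P₄ y) + when≢ x₃ y (P₃ y)) + when≢ x₂ y (P₂ y)) + when≢ x₁ y (P₁ y)) ≡ 0ℚ
  summand-cancellation y = begin
    summand y + six * (((when≢ x₄ y (P₄ y) + when≢ x₃ y (P₃ y)) + when≢ x₂ y (P₂ y)) + when≢ x₁ y (P₁ y))
      ≡⟨ cong₂ (λ s t → s + six * t) (summand-𝟙 y) (cong₂ _+_ (cong₂ _+_ (cong₂ _+_
           (when≢-R (P₄ y) x₄∈O (P₄-value y)) (when≢-R (P₃ y) x₃∈O (P₃-value y)))
           (when≢-R (P₂ y) x₂∈O (P₂-value y))) (when≢-R (P₁ y) x₁∈O (P₁-value y))) ⟩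
    r * (A y + S B) + six * (((r * (M₄ y + S Y₄) + r * (M₃ y + S Y₃)) + r * (M₂ y + S Y₂)) + r * (M₁ y + S Y₁))
      ≡⟨ regroup r (A y) (S B) (M₄ y) (S Y₄) (M₃ y) (S Y₃) (M₂ y) (S Y₂) (M₁ y) (S Y₁) ⟩
    r * ((A y + six * (((M₄ y + M₃ y) + M₂ y) + M₁ y)) + (S B + six * (((S Y₄ + S Y₃) + S Y₂) + S Y₁)))
      ≡⟨ cong (λ t → r * t) (cong₂ _+_ (A-cancellation y)
           (trans (∑-linear (allFin n) six _ _ _ _ _) (∑-zero (allFin n) (B-cancellation y)))) ⟩
    r * (0ℚ + 0ℚ)
      ≡⟨ ℚ.*-zeroʳ r ⟩
    0ℚ ∎
    where
      open ≡-Reasoning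
      r = 𝟙 (R y)
      S : (Fin n → Fin n → ℚ) → ℚ
      S f = ∑ᶠ (λ z → 𝟙 (inN G (y ∷ O) z) * f y z)
      regroup : ∀ r a b m₄ s₄ m₃ s₃ m₂ s₂ m₁ s₁ →
        r * (a + b) + six * (((r * (m₄ + s₄) + r * (m₃ + s₃)) + r * (m₂ + s₂)) + r * (m₁ + s₁))
        ≡ r * ((a + six * (((m₄ + m₃) + m₂) + m₁)) + (b + six * (((s₄ + s₃) + s₂) + s₁)))
      regroup = solve-∀ ℚ-ring

  W₃ : ℚ
  W₃ = W G (x₁ ∷ x₂ ∷ x₃ ∷ [])

  T₅₆-value : T₅₆ ≡ W₃ * c₁₁
  T₅₆-value = trans
    (∑-cong (allFin n) (λ a → ∑-collapse (t₅₆ a) x₁ (x₂ ∷ x₃ ∷ x₄ ∷ []) a c₁₁ (↭.shift a O []) (t₅₆≡ a)))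
    (∑-𝟙-W∷ʳ G x₁ (x₂ ∷ x₃ ∷ []) x₄ c₁₁ ↭.refl (Nsize>0 G δ>4n/5 O (s≤s z≤n) (s≤s (s≤s (s≤s (s≤s z≤n))))))

  12WG+∑summand≡W₃ : (+ 12 / 1) * WG G O + ∑ᶠ summand ≡ W₃
  12WG+∑summand≡W₃ = begin
    (+ 12 / 1) * WG G O + ∑ᶠ summand
      ≡⟨ cong (λ w → (+ 12 / 1) * w + ∑ᶠ summand) WG≡∑⊒ ⟩
    (+ 12 / 1) * ((+ 1 / 2) * ∑⊒ O 6 term) + ∑ᶠ summand
      ≡⟨ cong (λ t → (+ 12 / 1) * ((+ 1 / 2) * t) + ∑ᶠ summand) ∑⊒-unfold ⟩
    (+ 12 / 1) * ((+ 1 / 2) * ((((T₅₆ + ∑ᶠ N₄) + ∑ᶠ N₃) + ∑ᶠ N₂) + ∑ᶠ N₁)) + ∑ᶠ summand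
      ≡⟨ regroup T₅₆ (∑ᶠ N₄) (∑ᶠ N₃) (∑ᶠ N₂) (∑ᶠ N₁) (∑ᶠ summand) ⟩
    six * T₅₆ + (∑ᶠ summand + six * (((∑ᶠ N₄ + ∑ᶠ N₃) + ∑ᶠ N₂) + ∑ᶠ N₁))
      ≡⟨ cong₂ (λ t u → six * t + u) T₅₆-value
           (trans (∑-linear (allFin n) six summand N₄ N₃ N₂ N₁) (∑-zero (allFin n) summand-cancellation)) ⟩
    six * (W₃ * c₁₁) + 0ℚ
      ≡⟨ finish W₃ ⟩
    W₃ ∎
    where
      open ≡-Reasoning
      N₄ N₃ N₂ N₁ : Fin n → ℚ
      N₄ a = when≢ x₄ a (P₄ a)
      N₃ a = when≢ x₃ a (P₃ a)
      N₂ a = when≢ x₂ a (P₂ a)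
      N₁ a = when≢ x₁ a (P₁ a)
      regroup : ∀ t a b c d s → (+ 12 / 1) * ((+ 1 / 2) * ((((t + a) + b) + c) + d)) + s
                              ≡ six * t + (s + six * (((a + b) + c) + d))
      regroup = solve-∀ ℚ-ring
      finish : ∀ w → six * (w * c₁₁) + 0ℚ ≡ w
      finish = solve-∀ ℚ-ring

lemma2p4 : (n : ℕ) (G : Graph n) → MinDegGt45 G →
    (x₁ x₂ x₃ x₄ : Fin n) → OK G (x₁ ∷ x₂ ∷ x₃ ∷ x₄ ∷ []) →
    (W' G x₁ x₂ x₃ x₄ ≤ 1ℚ → 0ℚ ≤ WG G (x₁ ∷ x₂ ∷ x₃ ∷ x₄ ∷ []))
    ×
    (W' G x₁ x₂ x₃ x₄ ≡
      inv (W G (x₁ ∷ x₂ ∷ x₃ ∷ []))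
      * Σᵥ G (λ y → if inN G (x₁ ∷ x₂ ∷ x₃ ∷ x₄ ∷ []) y
          then ((+ 2 / 1) * W G (x₁ ∷ y ∷ x₂ ∷ x₃ ∷ [])
                - W G (x₁ ∷ x₂ ∷ x₃ ∷ y ∷ [])
                - W G (x₁ ∷ x₂ ∷ y ∷ x₃ ∷ [])
                + Σᵥ G (λ z → if adj G y z ∧ inN G (x₁ ∷ x₂ ∷ x₃ ∷ x₄ ∷ []) z
                    then ((+ 2 / 1) * W G (x₁ ∷ y ∷ x₂ ∷ x₃ ∷ z ∷ [])
                          + (+ 2 / 1) * W G (x₁ ∷ y ∷ x₂ ∷ z ∷ x₃ ∷ [])
                          + (+ 2 / 1) * W G (x₁ ∷ y ∷ z ∷ x₂ ∷ x₃ ∷ [])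
                          - W G (x₁ ∷ x₂ ∷ x₃ ∷ y ∷ z ∷ [])
                          - W G (x₁ ∷ x₂ ∷ y ∷ x₃ ∷ z ∷ [])
                          - W G (x₁ ∷ x₂ ∷ y ∷ z ∷ x₃ ∷ [])
                          - (+ 3 / 1) * W G (y ∷ z ∷ x₁ ∷ x₂ ∷ x₃ ∷ []))
                    else 0ℚ))
          else 0ℚ))
lemma2p4 n G δ>4n/5 x₁ x₂ x₃ x₄ O-clique = W'≤1⇒WG≥0 , W'≡
  where
    open Lemma2p4 G δ>4n/5 x₁ x₂ x₃ x₄ O-clique
    open ≡-Reasoning

    W₃>0 : Positive W₃
    W₃>0 = W-pos G δ>4n/5 (x₁ ∷ x₂ ∷ x₃ ∷ []) (s≤s (s≤s (s≤s z≤n)))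

    c : ℚ
    c = (+ 12 / 1) * inv W₃

    W'≤1⇒WG≥0 : W' G x₁ x₂ x₃ x₄ ≤ 1ℚ → 0ℚ ≤ WG G O
    W'≤1⇒WG≥0 W'≤1 = ℚ.*-cancelˡ-≤-pos c {{ℚ.pos*pos⇒pos (+ 12 / 1) (inv W₃) {{inv-pos W₃ W₃>0}}}}
      (subst (_≤ c * WG G O) (≡.sym (ℚ.*-zeroʳ c)) (1-p≤1⇒0≤p (c * WG G O) W'≤1))

    W'≡ : W' G x₁ x₂ x₃ x₄ ≡ inv W₃ * ∑ᶠ summand
    W'≡ = begin
      1ℚ - c * WG G O                                        ≡⟨ cong (_- c * WG G O) (inv-inverseˡ W₃ W₃>0) ⟨
      inv W₃ * W₃ - c * WG G O                               ≡⟨ cong (λ w → inv W₃ * w - c * WG G O) 12WG+∑summand≡W₃ ⟨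
      inv W₃ * ((+ 12 / 1) * WG G O + ∑ᶠ summand) - c * WG G O ≡⟨ cancel (inv W₃) (WG G O) (∑ᶠ summand) ⟩
      inv W₃ * ∑ᶠ summand                                    ∎
      where
        cancel : ∀ i x s → i * ((+ 12 / 1) * x + s) - ((+ 12 / 1) * i) * x ≡ i * s
        cancel = solve-∀ ℚ-ring
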